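{- Let $m,n\geq 2$ and let $W$ be a dominating set of the digraph $\overrightarrow{C_m}\Box \overrightarrow{C_n}$. For $i\in\{0,1,\dots,n-1\}$ let $C_m^i=\{(k,i)\mid k\in\{0,1,\dots,m-1\}\}$, with the index $i$ taken modulo $n$. Then for every $i\in\{0,1,\dots,n-1\}$, $$\left|W\cap C_m^{i-1}\right| + 2\left|W\cap C_m^{i}\right| \geq m.$$
   Context: For a digraph $D=(V,A)$, a vertex $u$ dominates $v$ if $u=v$ or $uv\in A$; a set $W\subseteq V$ is dominating if every vertex of $V$ is dominated by some vertex of $W$. The directed cycle $\overrightarrow{C_n}$ has vertex set $\{0,1,\dots,n-1\}$ (integers modulo $n$) and arcs $x\to x+1 \pmod n$. For digraphs $D_1=(V_1,A_1)$, $D_2=(V_2,A_2)$, the Cartesian product $D_1\Box D_2$ has vertex set $V_1\times V_2$ and an arc $(x_1,x_2)\to(y_1,y_2)$ iff either $x_1y_1\in A_1$ and $x_2=y_2$, or $x_2y_2\in A_2$ and $x_1=y_1$. -}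

module Defs where

open import Data.Nat using (ℕ; suc; _+_)
open import Data.Fin using (Fin; zero; suc; toℕ; fromℕ<)
open import Data.Bool using (Bool; true; false; if_then_else_)
open import Data.Product using (_×_; _,_; ∃-syntax)
open import Data.Sum using (_⊎_)
open import Relation.Binary.PropositionalEquality using (_≡_)
open import Data.Nat.DivMod using (_%_; m%n<n)

record Digraph : Set₁ where
  field
    V   : Set
    Arc : V → V → Set
open Digraph public

sucMod : ∀ {n} → Fin n → Fin n
sucMod {suc n} x = fromℕ< (m%n<n (suc (toℕ x)) (suc n))

-- Predecessor modulo n on Fin n : x ↦ (x - 1) mod n, i.e. x + (n - 1) mod n.
predMod : ∀ {n} → Fin n → Fin n
predMod {suc n} x = fromℕ< (m%n<n (toℕ x + n) (suc n))

dirCycle : ℕ → Digraph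
dirCycle n = record { V = Fin n ; Arc = λ x y → y ≡ sucMod x }

_□_ : Digraph → Digraph → Digraph
D₁ □ D₂ = record
  { V   = V D₁ × V D₂
  ; Arc = λ { (x₁ , x₂) (y₁ , y₂) →
              (Arc D₁ x₁ y₁ × x₂ ≡ y₂) ⊎ (Arc D₂ x₂ y₂ × x₁ ≡ y₁) } }

Dominates : (D : Digraph) → V D → V D → Set
Dominates D u v = (u ≡ v) ⊎ Arc D u v

IsDominating : (D : Digraph) → (V D → Bool) → Set
IsDominating D W = ∀ v → ∃[ u ] (W u ≡ true × Dominates D u v)

count : ∀ {m} → (Fin m → Bool) → ℕ
count {ℕ.zero} P = 0
count {suc m} P = (if P zero then 1 else 0) + count (λ k → P (suc k))

rowCount : ∀ {m n} → (Fin m × Fin n → Bool) → Fin n → ℕ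
rowCount W i = count (λ k → W (k , i))

module Submission where

-- Every vertex (k , i) of C⃗m □ C⃗n is dominated only by itself, by its
-- row-predecessor (k - 1 , i) and by its column-predecessor (k , i - 1).
-- Hence, for a dominating set W and a fixed row i, every k satisfies
--     W (k , i)  ∨  W (k - 1 , i)  ∨  W (k , i - 1).
-- Counting over k, the number of such k (which is m) is at most the sum of
-- the three counts (subadditivity of counting), and since k ↦ k - 1 is a
-- rotation of Z/m the second count equals the first.  This gives
--     m ≤ |W ∩ C_m^(i-1)| + 2 |W ∩ C_m^i| ,
-- without needing the hypotheses m, n ≥ 2.

open import Defs
open import Data.Nat using (ℕ; _≤_; _+_; _*_)
open import Data.Fin using (Fin)
open import Data.Product using (_×_)
open import Data.Bool using (Bool)

open import Data.Nat using (zero; suc; z≤n; s≤s; NonZero)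
open import Data.Nat.Properties
open import Data.Nat.DivMod using (_%_; m%n<n; %-distribˡ-+; m%n%n≡m%n; [m+n]%n≡m%n; m<n⇒m%n≡m; m≤n⇒m%n≡m)
open import Data.Fin using (zero; suc; toℕ; fromℕ; inject₁)
open import Data.Fin.Properties using (toℕ-injective; toℕ-fromℕ<; toℕ-fromℕ; toℕ-inject₁; toℕ<n)
open import Data.Bool using (true; false; _∨_; if_then_else_)
open import Data.Bool.Properties using (∨-zeroʳ)
open import Data.Product using (_,_)
open import Data.Sum using (_⊎_; inj₁; inj₂)
open import Relation.Binary.PropositionalEquality
open import Algebra.Properties.CommutativeSemigroup +-commutativeSemigroup using (interchange)

%-absorbˡ : ∀ a b N .{{_ : NonZero N}} → (a % N + b) % N ≡ (a + b) % N
%-absorbˡ a b N = begin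
    (a % N + b) % N          ≡⟨ %-distribˡ-+ (a % N) b N ⟩
    (a % N % N + b % N) % N  ≡⟨ cong (λ v → (v + b % N) % N) (m%n%n≡m%n a N) ⟩
    (a % N + b % N) % N      ≡⟨ sym (%-distribˡ-+ a b N) ⟩
    (a + b) % N              ∎
  where open ≡-Reasoning

predMod-sucMod : ∀ {N} (x : Fin N) → predMod (sucMod x) ≡ x
predMod-sucMod {suc n} x = toℕ-injective (begin
    toℕ (predMod (sucMod x))         ≡⟨ toℕ-fromℕ< _ ⟩
    (toℕ (sucMod x) + n) % suc n
      ≡⟨ cong (λ v → (v + n) % suc n) (toℕ-fromℕ< (m%n<n (suc (toℕ x)) (suc n))) ⟩
    (suc (toℕ x) % suc n + n) % suc n ≡⟨ %-absorbˡ (suc (toℕ x)) n (suc n) ⟩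
    (suc (toℕ x) + n) % suc n        ≡⟨ cong (_% suc n) (sym (+-suc (toℕ x) n)) ⟩
    (toℕ x + suc n) % suc n          ≡⟨ [m+n]%n≡m%n (toℕ x) (suc n) ⟩
    toℕ x % suc n                    ≡⟨ m<n⇒m%n≡m (toℕ<n x) ⟩
    toℕ x                            ∎)
  where open ≡-Reasoning

predMod-zero : ∀ n → predMod {suc n} zero ≡ fromℕ n
predMod-zero n = toℕ-injective (begin
    toℕ (predMod {suc n} zero) ≡⟨ toℕ-fromℕ< _ ⟩
    n % suc n                  ≡⟨ m≤n⇒m%n≡m ≤-refl ⟩
    n                          ≡⟨ sym (toℕ-fromℕ n) ⟩
    toℕ (fromℕ n)              ∎)
  where open ≡-Reasoning

predMod-suc : ∀ n (j : Fin n) → predMod {suc n} (suc j) ≡ inject₁ j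
predMod-suc n j = toℕ-injective (begin
    toℕ (predMod {suc n} (suc j)) ≡⟨ toℕ-fromℕ< _ ⟩
    (suc (toℕ j) + n) % suc n     ≡⟨ cong (_% suc n) (sym (+-suc (toℕ j) n)) ⟩
    (toℕ j + suc n) % suc n       ≡⟨ [m+n]%n≡m%n (toℕ j) (suc n) ⟩
    toℕ j % suc n                 ≡⟨ m<n⇒m%n≡m (m≤n⇒m≤1+n (toℕ<n j)) ⟩
    toℕ j                         ≡⟨ sym (toℕ-inject₁ j) ⟩
    toℕ (inject₁ j)               ∎)
  where open ≡-Reasoning

bit : Bool → ℕ
bit b = if b then 1 else 0

count-cong : ∀ {m} {P Q : Fin m → Bool} → (∀ k → P k ≡ Q k) → count P ≡ count Q
count-cong {zero}  eq = refl
count-cong {suc m} eq = cong₂ _+_ (cong bit (eq zero)) (count-cong (λ k → eq (suc k)))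

count-last : ∀ m (P : Fin (suc m) → Bool) →
  count P ≡ count (λ k → P (inject₁ k)) + bit (P (fromℕ m))
count-last zero    P = +-identityʳ _
count-last (suc m) P = begin
    bit (P zero) + count (λ k → P (suc k))
      ≡⟨ cong (bit (P zero) +_) (count-last m (λ k → P (suc k))) ⟩
    bit (P zero) + (count (λ k → P (suc (inject₁ k))) + bit (P (fromℕ (suc m))))
      ≡⟨ sym (+-assoc (bit (P zero)) _ _) ⟩
    count (λ k → P (inject₁ k)) + bit (P (fromℕ (suc m))) ∎
  where open ≡-Reasoning

count-predMod : ∀ m (P : Fin m → Bool) → count (λ k → P (predMod k)) ≡ count P
count-predMod zero    P = refl
count-predMod (suc n) P = begin
    bit (P (predMod zero)) + count (λ k → P (predMod (suc k)))
      ≡⟨ cong₂ _+_ (cong (λ v → bit (P v)) (predMod-zero n))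
                   (count-cong (λ k → cong P (predMod-suc n k))) ⟩
    bit (P (fromℕ n)) + count (λ k → P (inject₁ k))
      ≡⟨ +-comm (bit (P (fromℕ n))) _ ⟩
    count (λ k → P (inject₁ k)) + bit (P (fromℕ n))
      ≡⟨ sym (count-last n P) ⟩
    count P ∎
  where open ≡-Reasoning

count-full : ∀ {m} (P : Fin m → Bool) → (∀ k → P k ≡ true) → count P ≡ m
count-full {zero}  P all = refl
count-full {suc m} P all rewrite all zero = cong suc (count-full _ (λ k → all (suc k)))

bit-∨ : ∀ x y → bit (x ∨ y) ≤ bit x + bit y
bit-∨ true  y = s≤s z≤n
bit-∨ false y = ≤-refl

count-∨ : ∀ {m} (P Q : Fin m → Bool) →
  count (λ k → P k ∨ Q k) ≤ count P + count Q
count-∨ {zero}  P Q = z≤n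
count-∨ {suc m} P Q = ≤-trans
  (+-mono-≤ (bit-∨ (P zero) (Q zero)) (count-∨ (λ k → P (suc k)) (λ k → Q (suc k))))
  (≤-reflexive (interchange (bit (P zero)) (bit (Q zero)) _ _))

dominators : ∀ {m n} {u : Fin m × Fin n} (k : Fin m) (i : Fin n) →
  Dominates (dirCycle m □ dirCycle n) u (k , i) →
  (u ≡ (k , i)) ⊎ ((u ≡ (predMod k , i)) ⊎ (u ≡ (k , predMod i)))
dominators _ _ (inj₁ refl) = inj₁ refl
dominators {u = u₁ , u₂} _ _ (inj₂ (inj₁ (refl , refl))) =
  inj₂ (inj₁ (cong (_, u₂) (sym (predMod-sucMod u₁))))
dominators {u = u₁ , u₂} _ _ (inj₂ (inj₂ (refl , refl))) =
  inj₂ (inj₂ (cong (u₁ ,_) (sym (predMod-sucMod u₂))))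

row-covered : ∀ {m n} (W : Fin m × Fin n → Bool) →
  IsDominating (dirCycle m □ dirCycle n) W → (i : Fin n) (k : Fin m) →
  W (k , predMod i) ∨ (W (k , i) ∨ W (predMod k , i)) ≡ true
row-covered W dom i k with dom (k , i)
... | u , Wu , u→ki with dominators k i u→ki
...   | inj₁ refl        rewrite Wu = ∨-zeroʳ _
...   | inj₂ (inj₁ refl) rewrite Wu | ∨-zeroʳ (W (k , i)) = ∨-zeroʳ _
...   | inj₂ (inj₂ refl) rewrite Wu = refl

mainTheorem1 : (m n : ℕ) → 2 ≤ m → 2 ≤ n →
    (W : Fin m × Fin n → Bool) →
    IsDominating (dirCycle m □ dirCycle n) W →
    (i : Fin n) →
    m ≤ rowCount W (predMod i) + 2 * rowCount W i
mainTheorem1 m n _ _ W dom i = begin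
    m
      ≡⟨ sym (count-full _ (row-covered W dom i)) ⟩
    count (λ k → below k ∨ (row k ∨ row (predMod k)))
      ≤⟨ count-∨ below _ ⟩
    count below + count (λ k → row k ∨ row (predMod k))
      ≤⟨ +-monoʳ-≤ (count below) (count-∨ row _) ⟩
    count below + (count row + count (λ k → row (predMod k)))
      ≡⟨ cong (λ c → count below + (count row + c))
              (trans (count-predMod m row) (sym (+-identityʳ _))) ⟩
    count below + 2 * count row ∎
  where
  open ≤-Reasoning
  row below : Fin m → Bool
  row   k = W (k , i)
  below k = W (k , predMod i)
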